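{- For every odd $n\geqslant 7$, the partition $\left(\frac{n-1}{2},3,1\times\frac{n-5}{2}\right)$ of $n$ corresponds to the eigenvalue $1$ of the Transposition graph $T_n$. For every even $n\geqslant 14$, the partition $\left(\frac{n-6}{2},4,4,2,1\times\frac{n-14}{2}\right)$ of $n$ corresponds to the eigenvalue $1$ of $T_n$. In particular, $1$ is an eigenvalue of $T_n$ for all odd $n\geqslant 7$ and all even $n\geqslant 14$.
   Context: The Transposition graph $T_n$ is the Cayley graph on the symmetric group $\mathrm{Sym}_n$ generated by the set of all transpositions. Its eigenvalues (of the adjacency matrix) are indexed by partitions of $n$: to a partition $\mathbf{i}=(n_1,\dots,n_k)\vdash n$ with $n_1\geqslant\dots\geqslant n_k\geqslant 1$ corresponds the eigenvalue $\lambda_{\mathbf i}=\sum_{j=1}^k \frac{n_j(n_j-2j+1)}{2}$ of $T_n$, and every eigenvalue arises this way. "The partition $\mathbf i$ corresponds to the eigenvalue $\lambda$" means $\lambda_{\mathbf i}=\lambda$. The notation $(n_1,\dots,n_r,a\times t)$ denotes the partition in which the part $a$ is appended $t$ times ($t\geqslant 0$). -}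

module Defs where

open import Data.Nat as ℕ using (ℕ; zero; suc; _≥_)
open import Data.Integer as ℤ using (ℤ; +_; _/ℕ_)
open import Data.List using (List; []; _∷_)
open import Data.Nat.ListAction using (sum)
open import Data.List.Relation.Unary.All using (All)
open import Data.List.Relation.Unary.Linked using (Linked)
open import Data.Product using (Σ; _×_)
open import Relation.Binary.PropositionalEquality using (_≡_)

record IsPartition (n : ℕ) (p : List ℕ) : Set where
  field
    positive    : All (λ a → a ≥ 1) p
    nonincrease : Linked _≥_ p
    sums        : sum p ≡ n

eigSumFrom : ℕ → List ℕ → ℤ
eigSumFrom j []       = + 0
eigSumFrom j (a ∷ as) =
  ((+ a ℤ.* (+ a ℤ.- + (2 ℕ.* j) ℤ.+ + 1)) /ℕ 2) ℤ.+ eigSumFrom (suc j) as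

-- λ_i = Σ_{j=1}^{k} n_j (n_j - 2j + 1) / 2   (each term is an integer)
eigenvalueOf : List ℕ → ℤ
eigenvalueOf p = eigSumFrom 1 p

-- "λ is an eigenvalue of the Transposition graph T_n": by the stated
-- theorem, the eigenvalues are exactly the λ_i for partitions i ⊢ n.
IsEigenvalueT : ℕ → ℤ → Set
IsEigenvalueT n λ' = Σ (List ℕ) (λ p → IsPartition n p × eigenvalueOf p ≡ λ')

module Submission where

-- The summand of λ for a part a in position j is C(a,2) − a(j−1). Lengthening the first part
-- of (ℓ, n₂, …, n_ℓ) to ℓ + m raises its summand by C(ℓ+m,2) − C(ℓ,2) = ℓ + (ℓ+1) + … + (ℓ+m−1),
-- which is exactly what m parts equal to 1 in positions ℓ+1, …, ℓ+m subtract. Hence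
-- λ(ℓ+m, n₂, …, n_ℓ, 1×m) = λ(ℓ, n₂, …, n_ℓ), and the two families reduce to λ(2,3) = 1 and
-- λ(4,4,4,2) = 1.

open import Defs
open import Data.Nat using (ℕ; _≥_; _∸_; _/_; _%_)
open import Data.Integer using (+_)
open import Data.List using (List; _∷_; []; replicate; _++_)
open import Data.Product using (_×_)
open import Data.Sum using (_⊎_)
open import Relation.Binary.PropositionalEquality using (_≡_)

open import Data.Nat as ℕ using (zero; suc; _+_; _*_; _≤_; s≤s; z≤n)
open import Data.Nat.Combinatorics using (_C_; nC1≡n; nCk+nC[k+1]≡[n+1]C[k+1])
open import Data.Nat.DivMod using (m≡m%n+[m/n]*n; m*n/n≡m; m*n%n≡0)
open import Data.Nat.ListAction using (sum)
import Data.Nat.Properties as ℕ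
import Data.Nat.Tactic.RingSolver as ℕ-Solver
open import Data.Integer as ℤ using (ℤ; -[1+_]; -_; _/ℕ_)
import Data.Integer.Properties as ℤ
import Data.Integer.Tactic.RingSolver as ℤ-Solver
open import Algebra.Properties.CommutativeSemigroup ℤ.+-commutativeSemigroup using (x∙yz≈y∙xz)
open import Data.List using (length)
open import Data.List.Relation.Unary.All using (_∷_)
open import Data.List.Relation.Unary.All.Properties using (replicate⁺)
open import Data.List.Relation.Unary.Linked using (Linked; [-]; _∷_)
open import Data.Product using (∃-syntax; _,_)
open import Data.Sum using (inj₁; inj₂)
open import Relation.Binary.PropositionalEquality using (refl; sym; trans; cong; cong₂; subst; module ≡-Reasoning)
open ≡-Reasoning

i*n/ℕn≡i : ∀ i n .{{_ : ℕ.NonZero n}} → (i ℤ.* + n) /ℕ n ≡ i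
i*n/ℕn≡i (+ m) n = begin
  (+ m ℤ.* + n) /ℕ n  ≡⟨ cong (_/ℕ n) (ℤ.pos-* m n) ⟨
  + (m * n / n)       ≡⟨ cong +_ (m*n/n≡m m n) ⟩
  + m                 ∎
i*n/ℕn≡i -[1+ m ] (suc n)
  -- rewrite does not insert instance arguments by itself
  rewrite m*n%n≡0 (suc m) (suc n) ⦃ _ ⦄ | m*n/n≡m (suc m) (suc n) ⦃ _ ⦄ = refl

[1+n]C2≡n+nC2 : ∀ n → suc n C 2 ≡ n + n C 2
[1+n]C2≡n+nC2 n = begin
  suc n C 2        ≡⟨ nCk+nC[k+1]≡[n+1]C[k+1] n 1 ⟨
  n C 1 + n C 2    ≡⟨ cong (_+ n C 2) (nC1≡n n) ⟩
  n + n C 2        ∎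

nC2*2+n≡n*n : ∀ n → (n C 2) * 2 + n ≡ n * n
nC2*2+n≡n*n zero    = refl
nC2*2+n≡n*n (suc n) = begin
  (suc n C 2) * 2 + suc n          ≡⟨ cong (λ c → c * 2 + suc n) ([1+n]C2≡n+nC2 n) ⟩
  (n + n C 2) * 2 + suc n          ≡⟨ shuffle n (n C 2) ⟩
  ((n C 2) * 2 + n) + suc (n * 2)  ≡⟨ cong (_+ suc (n * 2)) (nC2*2+n≡n*n n) ⟩
  n * n + suc (n * 2)              ≡⟨ square n ⟩
  suc n * suc n                    ∎
  where
  shuffle : ∀ n c → (n + c) * 2 + suc n ≡ (c * 2 + n) + suc (n * 2)
  shuffle = ℕ-Solver.solve-∀
  square : ∀ n → n * n + suc (n * 2) ≡ suc n * suc n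
  square = ℕ-Solver.solve-∀

eigTerm : ℕ → ℕ → ℤ
eigTerm j a = (+ a ℤ.* (+ a ℤ.- + (2 * j) ℤ.+ + 1)) /ℕ 2

eigTerm-suc : ∀ i a → eigTerm (suc i) a ≡ + (a C 2) ℤ.- + (a * i)
eigTerm-suc i a = begin
  (+ a ℤ.* (+ a ℤ.- + (2 * suc i) ℤ.+ + 1)) /ℕ 2
    ≡⟨ cong (λ t → (+ a ℤ.* (+ a ℤ.- t ℤ.+ + 1)) /ℕ 2) 2[1+i] ⟩
  (+ a ℤ.* (+ a ℤ.- + 2 ℤ.* (+ 1 ℤ.+ + i) ℤ.+ + 1)) /ℕ 2
    ≡⟨ cong (_/ℕ 2) (x[x-2[1+y]+1]≡[c-xy]*2 (+ a) (+ i) (+ (a C 2)) C*2+a≡a*a) ⟩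
  ((+ (a C 2) ℤ.- + a ℤ.* + i) ℤ.* + 2) /ℕ 2
    ≡⟨ i*n/ℕn≡i (+ (a C 2) ℤ.- + a ℤ.* + i) 2 ⟩
  + (a C 2) ℤ.- + a ℤ.* + i
    ≡⟨ cong (λ t → + (a C 2) ℤ.- t) (ℤ.pos-* a i) ⟨
  + (a C 2) ℤ.- + (a * i)
    ∎
  where
  2[1+i] : + (2 * suc i) ≡ + 2 ℤ.* (+ 1 ℤ.+ + i)
  2[1+i] = trans (ℤ.pos-* 2 (suc i)) (cong (+ 2 ℤ.*_) (ℤ.pos-+ 1 i))

  C*2+a≡a*a : + (a C 2) ℤ.* + 2 ℤ.+ + a ≡ + a ℤ.* + a
  C*2+a≡a*a = begin
    + (a C 2) ℤ.* + 2 ℤ.+ + a   ≡⟨ cong (ℤ._+ + a) (ℤ.pos-* (a C 2) 2) ⟨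
    + ((a C 2) * 2) ℤ.+ + a     ≡⟨ ℤ.pos-+ ((a C 2) * 2) a ⟨
    + ((a C 2) * 2 + a)         ≡⟨ cong +_ (nC2*2+n≡n*n a) ⟩
    + (a * a)                   ≡⟨ ℤ.pos-* a a ⟩
    + a ℤ.* + a                 ∎

  x[x-2[1+y]+1]≡[c-xy]*2 : ∀ x y c → c ℤ.* + 2 ℤ.+ x ≡ x ℤ.* x →
              x ℤ.* (x ℤ.- + 2 ℤ.* (+ 1 ℤ.+ y) ℤ.+ + 1) ≡ (c ℤ.- x ℤ.* y) ℤ.* + 2
  x[x-2[1+y]+1]≡[c-xy]*2 x y c c*2+x≡x*x = begin
    x ℤ.* (x ℤ.- + 2 ℤ.* (+ 1 ℤ.+ y) ℤ.+ + 1)   ≡⟨ expand x y ⟩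
    x ℤ.* x ℤ.- x ℤ.- x ℤ.* y ℤ.* + 2           ≡⟨ cong (λ t → t ℤ.- x ℤ.- x ℤ.* y ℤ.* + 2) c*2+x≡x*x ⟨
    c ℤ.* + 2 ℤ.+ x ℤ.- x ℤ.- x ℤ.* y ℤ.* + 2   ≡⟨ collect x y c ⟩
    (c ℤ.- x ℤ.* y) ℤ.* + 2                     ∎
    where
    expand : ∀ x y → x ℤ.* (x ℤ.- + 2 ℤ.* (+ 1 ℤ.+ y) ℤ.+ + 1) ≡ x ℤ.* x ℤ.- x ℤ.- x ℤ.* y ℤ.* + 2
    expand = ℤ-Solver.solve-∀
    collect : ∀ x y c → c ℤ.* + 2 ℤ.+ x ℤ.- x ℤ.- x ℤ.* y ℤ.* + 2 ≡ (c ℤ.- x ℤ.* y) ℤ.* + 2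
    collect = ℤ-Solver.solve-∀

eigTerm-first : ∀ a → eigTerm 1 a ≡ + (a C 2)
eigTerm-first a = begin
  eigTerm 1 a                  ≡⟨ eigTerm-suc 0 a ⟩
  + (a C 2) ℤ.- + (a * 0)      ≡⟨ cong (λ t → + (a C 2) ℤ.- + t) (ℕ.*-zeroʳ a) ⟩
  + (a C 2) ℤ.+ + 0            ≡⟨ ℤ.+-identityʳ (+ (a C 2)) ⟩
  + (a C 2)                    ∎

eigTerm-one : ∀ j → eigTerm (suc j) 1 ≡ - + j
eigTerm-one j = begin
  eigTerm (suc j) 1            ≡⟨ eigTerm-suc j 1 ⟩
  + 0 ℤ.- + (j + 0)            ≡⟨ ℤ.+-identityˡ (- + (j + 0)) ⟩
  - + (j + 0)                  ≡⟨ cong (λ t → - + t) (ℕ.+-identityʳ j) ⟩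
  - + j                        ∎

eigSumFrom-++ : ∀ j xs ys → eigSumFrom j (xs ++ ys) ≡ eigSumFrom j xs ℤ.+ eigSumFrom (j + length xs) ys
eigSumFrom-++ j []       ys = sym (trans (ℤ.+-identityˡ _) (cong (λ k → eigSumFrom k ys) (ℕ.+-identityʳ j)))
eigSumFrom-++ j (x ∷ xs) ys = begin
  eigTerm j x ℤ.+ eigSumFrom (suc j) (xs ++ ys)
    ≡⟨ cong (λ s → eigTerm j x ℤ.+ s) (eigSumFrom-++ (suc j) xs ys) ⟩
  eigTerm j x ℤ.+ (eigSumFrom (suc j) xs ℤ.+ eigSumFrom (suc j + length xs) ys)
    ≡⟨ ℤ.+-assoc (eigTerm j x) _ _ ⟨
  eigTerm j x ℤ.+ eigSumFrom (suc j) xs ℤ.+ eigSumFrom (suc j + length xs) ys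
    ≡⟨ cong (λ k → eigSumFrom j (x ∷ xs) ℤ.+ eigSumFrom k ys) (ℕ.+-suc j (length xs)) ⟨
  eigSumFrom j (x ∷ xs) ℤ.+ eigSumFrom (j + suc (length xs)) ys
    ∎

[j+m]C2+eigSumFrom-ones≡jC2 : ∀ j m → + ((j + m) C 2) ℤ.+ eigSumFrom (suc j) (replicate m 1) ≡ + (j C 2)
[j+m]C2+eigSumFrom-ones≡jC2 j zero = begin
  + ((j + 0) C 2) ℤ.+ + 0   ≡⟨ ℤ.+-identityʳ _ ⟩
  + ((j + 0) C 2)           ≡⟨ cong (λ k → + (k C 2)) (ℕ.+-identityʳ j) ⟩
  + (j C 2)                 ∎
[j+m]C2+eigSumFrom-ones≡jC2 j (suc m) = begin
  + ((j + suc m) C 2) ℤ.+ (eigTerm (suc j) 1 ℤ.+ ones)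
    ≡⟨ cong₂ (λ k t → + (k C 2) ℤ.+ (t ℤ.+ ones)) (ℕ.+-suc j m) (eigTerm-one j) ⟩
  + ((suc j + m) C 2) ℤ.+ (- + j ℤ.+ ones)
    ≡⟨ x∙yz≈y∙xz (+ ((suc j + m) C 2)) (- + j) ones ⟩
  - + j ℤ.+ (+ ((suc j + m) C 2) ℤ.+ ones)
    ≡⟨ cong (λ t → - + j ℤ.+ t) ([j+m]C2+eigSumFrom-ones≡jC2 (suc j) m) ⟩
  - + j ℤ.+ + (suc j C 2)
    ≡⟨ cong (λ t → - + j ℤ.+ t) (trans (cong +_ ([1+n]C2≡n+nC2 j)) (ℤ.pos-+ j (j C 2))) ⟩
  - + j ℤ.+ (+ j ℤ.+ + (j C 2))
    ≡⟨ -x+[x+y]≡y (+ j) (+ (j C 2)) ⟩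
  + (j C 2)
    ∎
  where
  ones : ℤ
  ones = eigSumFrom (suc (suc j)) (replicate m 1)
  -x+[x+y]≡y : ∀ x y → - x ℤ.+ (x ℤ.+ y) ≡ y
  -x+[x+y]≡y = ℤ-Solver.solve-∀

eigenvalueOf-pad : ∀ mid m →
  eigenvalueOf ((suc (length mid) + m) ∷ mid ++ replicate m 1) ≡ eigenvalueOf (suc (length mid) ∷ mid)
eigenvalueOf-pad mid m = begin
  eigTerm 1 (ℓ + m) ℤ.+ eigSumFrom 2 (mid ++ replicate m 1)
    ≡⟨ cong₂ ℤ._+_ (eigTerm-first (ℓ + m)) (eigSumFrom-++ 2 mid (replicate m 1)) ⟩
  + ((ℓ + m) C 2) ℤ.+ (eigSumFrom 2 mid ℤ.+ eigSumFrom (suc ℓ) (replicate m 1))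
    ≡⟨ x∙yz≈y∙xz (+ ((ℓ + m) C 2)) (eigSumFrom 2 mid) _ ⟩
  eigSumFrom 2 mid ℤ.+ (+ ((ℓ + m) C 2) ℤ.+ eigSumFrom (suc ℓ) (replicate m 1))
    ≡⟨ cong (λ t → eigSumFrom 2 mid ℤ.+ t) ([j+m]C2+eigSumFrom-ones≡jC2 ℓ m) ⟩
  eigSumFrom 2 mid ℤ.+ + (ℓ C 2)
    ≡⟨ ℤ.+-comm (eigSumFrom 2 mid) _ ⟩
  + (ℓ C 2) ℤ.+ eigSumFrom 2 mid
    ≡⟨ cong (ℤ._+ eigSumFrom 2 mid) (eigTerm-first ℓ) ⟨
  eigTerm 1 ℓ ℤ.+ eigSumFrom 2 mid
    ∎
  where
  ℓ : ℕ
  ℓ = suc (length mid)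

sum-replicate : ∀ m x → sum (replicate m x) ≡ m * x
sum-replicate zero    x = refl
sum-replicate (suc m) x = cong (λ s → x + s) (sum-replicate m x)

Linked-replicate : ∀ {A : Set} {R : A → A → Set} {x y} m → R x y → R y y → Linked R (x ∷ replicate m y)
Linked-replicate zero    Rxy Ryy = [-]
Linked-replicate (suc m) Rxy Ryy = Rxy ∷ Linked-replicate m Ryy Ryy

oddPartition-isPartition : ∀ k → IsPartition (1 + (3 + k) * 2) ((3 + k) ∷ 3 ∷ replicate (suc k) 1)
oddPartition-isPartition k = record
  { positive    = s≤s z≤n ∷ s≤s z≤n ∷ replicate⁺ (suc k) (s≤s z≤n)
  ; nonincrease = ℕ.m≤m+n 3 k ∷ Linked-replicate (suc k) (s≤s z≤n) ℕ.≤-refl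
  ; sums        = trans (cong (λ s → 3 + k + (3 + s)) (sum-replicate (suc k) 1)) (total k)
  }
  where
  total : ∀ k → 3 + k + (3 + suc k * 1) ≡ 1 + (3 + k) * 2
  total = ℕ-Solver.solve-∀

evenPartition-isPartition : ∀ k → IsPartition ((7 + k) * 2) ((4 + k) ∷ 4 ∷ 4 ∷ 2 ∷ replicate k 1)
evenPartition-isPartition k = record
  { positive    = s≤s z≤n ∷ s≤s z≤n ∷ s≤s z≤n ∷ s≤s z≤n ∷ replicate⁺ k (s≤s z≤n)
  ; nonincrease = ℕ.m≤m+n 4 k ∷ ℕ.≤-refl ∷ ℕ.m≤m+n 2 2 ∷ Linked-replicate k (s≤s z≤n) ℕ.≤-refl
  ; sums        = trans (cong (λ s → 4 + k + (4 + (4 + (2 + s)))) (sum-replicate k 1)) (total k)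
  }
  where
  total : ∀ k → 4 + k + (4 + (4 + (2 + k * 1))) ≡ (7 + k) * 2
  total = ℕ-Solver.solve-∀

m%n≡r⇒m≡r+[c+k]*n : ∀ {m n r} c .{{_ : ℕ.NonZero n}} → m % n ≡ r → r + c * n ≤ m → ∃[ k ] m ≡ r + (c + k) * n
m%n≡r⇒m≡r+[c+k]*n {m} {n} {r} c m%n≡r r+c*n≤m = q ∸ c , (begin
  m                    ≡⟨ m≡r+q*n ⟩
  r + q * n            ≡⟨ cong (λ t → r + t * n) (ℕ.m+[n∸m]≡n c≤q) ⟨
  r + (c + (q ∸ c)) * n ∎)
  where
  q : ℕ
  q = m / n
  m≡r+q*n : m ≡ r + q * n
  m≡r+q*n = trans (m≡m%n+[m/n]*n m n) (cong (_+ q * n) m%n≡r)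
  c≤q : c ≤ q
  c≤q = ℕ.*-cancelʳ-≤ c q n (ℕ.+-cancelˡ-≤ r _ _ (subst (r + c * n ≤_) m≡r+q*n r+c*n≤m))

CorrespondsTo : ℕ → List ℕ → ℤ → Set
CorrespondsTo n p λ′ = IsPartition n p × eigenvalueOf p ≡ λ′

oddPartition : ℕ → List ℕ
oddPartition n = ((n ∸ 1) / 2) ∷ 3 ∷ replicate ((n ∸ 5) / 2) 1

evenPartition : ℕ → List ℕ
evenPartition n = ((n ∸ 6) / 2) ∷ 4 ∷ 4 ∷ 2 ∷ replicate ((n ∸ 14) / 2) 1

oddPartition-eigenvalue : ∀ n → n ≥ 7 → n % 2 ≡ 1 → CorrespondsTo n (oddPartition n) (+ 1)
oddPartition-eigenvalue n n≥7 odd with m%n≡r⇒m≡r+[c+k]*n 3 odd n≥7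
... | k , refl = subst (λ p → CorrespondsTo (1 + (3 + k) * 2) p (+ 1)) (sym halves)
                   (oddPartition-isPartition k , eigenvalueOf-pad (3 ∷ []) (suc k))
  where
  halves : oddPartition (1 + (3 + k) * 2) ≡ (3 + k) ∷ 3 ∷ replicate (suc k) 1
  halves = cong₂ (λ a m → a ∷ 3 ∷ replicate m 1) (m*n/n≡m (3 + k) 2) (m*n/n≡m (suc k) 2)

evenPartition-eigenvalue : ∀ n → n ≥ 14 → n % 2 ≡ 0 → CorrespondsTo n (evenPartition n) (+ 1)
evenPartition-eigenvalue n n≥14 even with m%n≡r⇒m≡r+[c+k]*n 7 even n≥14
... | k , refl = subst (λ p → CorrespondsTo ((7 + k) * 2) p (+ 1)) (sym halves)
                   (evenPartition-isPartition k , eigenvalueOf-pad (4 ∷ 4 ∷ 2 ∷ []) k)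
  where
  halves : evenPartition ((7 + k) * 2) ≡ (4 + k) ∷ 4 ∷ 4 ∷ 2 ∷ replicate k 1
  halves = cong₂ (λ a m → a ∷ 4 ∷ 4 ∷ 2 ∷ replicate m 1) (m*n/n≡m (4 + k) 2) (m*n/n≡m k 2)

lemma2 : ((n : ℕ) → n ≥ 7 → n % 2 ≡ 1 →
           IsPartition n (((n ∸ 1) / 2) ∷ 3 ∷ replicate ((n ∸ 5) / 2) 1)
           × eigenvalueOf (((n ∸ 1) / 2) ∷ 3 ∷ replicate ((n ∸ 5) / 2) 1) ≡ + 1)
       × ((n : ℕ) → n ≥ 14 → n % 2 ≡ 0 →
           IsPartition n (((n ∸ 6) / 2) ∷ 4 ∷ 4 ∷ 2 ∷ replicate ((n ∸ 14) / 2) 1)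
           × eigenvalueOf (((n ∸ 6) / 2) ∷ 4 ∷ 4 ∷ 2 ∷ replicate ((n ∸ 14) / 2) 1) ≡ + 1)
       × ((n : ℕ) → ((n ≥ 7 × n % 2 ≡ 1) ⊎ (n ≥ 14 × n % 2 ≡ 0)) → IsEigenvalueT n (+ 1))
lemma2 = oddPartition-eigenvalue , evenPartition-eigenvalue , eigenvalue-one
  where
  eigenvalue-one : (n : ℕ) → ((n ≥ 7 × n % 2 ≡ 1) ⊎ (n ≥ 14 × n % 2 ≡ 0)) → IsEigenvalueT n (+ 1)
  eigenvalue-one n (inj₁ (n≥7 , odd))   = oddPartition n , oddPartition-eigenvalue n n≥7 odd
  eigenvalue-one n (inj₂ (n≥14 , even)) = evenPartition n , evenPartition-eigenvalue n n≥14 even
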